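{- Let $S$ be a set of positive integers and $t$ a nonnegative integer. Let $G_1,G_2$ be graphs; for each $i\in[2]$ let $Q_i$ be a clique in $G_i$ with $|Q_i|=t$ and let $\mathcal C_i$ be a collection of subsets of $V(G_i)$ with $Q_i\in\mathcal C_i$. Let $\iota$ be a bijection from $Q_1$ to $Q_2$. For each $i$ let $L_i$ be a list-assignment of $G_i$ with $L_1(x)=L_2(\iota(x))$ for all $x\in Q_1$. Let $G$ be a $(Q_1,Q_2,\iota)$-sum of $G_1$ and $G_2$ and $L$ the list-assignment of $G$ obtained by this $(Q_1,Q_2,\iota)$-sum. If $G_1$ is $(S,\mathcal C_1,L_1,t_1)$-extendable and $G_2$ is $(S,\mathcal C_2,L_2,t_2)$-extendable for some integers $t_1\ge t$ and $t_2\ge t$, then $G$ is $(S,\mathcal C_1\cup\mathcal C_2,L,\min\{t_1,t_2\})$-extendable.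
   Context: All graphs are finite and simple. A list-assignment of $G$ assigns to each vertex $v$ a set $L(v)$; an $L$-coloring $\phi$ has $\phi(v)\in L(v)$; it is proper if adjacent vertices receive different colors. $(Q_1,Q_2,\iota)$-sum: from the disjoint union of $G_1$ and $G_2$, for each $x\in Q_1$ identify $x$ and $\iota(x)$ into a new vertex $v_x$, and then delete any number of edges with both ends in $\{v_x:x\in Q_1\}$. The list-assignment $L$ obtained by it is $L(v)=L_1(v)$ for $v\in V(G_1)-Q_1$, $L(v)=L_2(v)$ for $v\in V(G_2)-Q_2$, and $L(v_x)=L_1(x)=L_2(\iota(x))$. For a collection $\mathcal C$ of subsets of $V(G)$, a subgraph $H$ of $G$ is $\mathcal C$-compatible if each edge of $H$ has both ends in some member of $\mathcal C$. For a set $S$ of positive integers, a nonnegative integer $t$ and a list-assignment $L$, $G$ is $(S,\mathcal C,L,t)$-extendable if for every clique $W$ of $G$ with $|W|\le t$, every $\mathcal C$-compatible subgraph $H$ of $G$, every proper $L|_W$-coloring $\phi_W$ of $G[W]$, every function $f$ with domain $W$, and every function $g:W\to\{0,1\}$, there is a proper $L$-coloring $\phi$ of $G$ with $\phi(v)=\phi_W(v)$ for all $v\in W$ such that for every $v\in V(G)$: if $v\in W$ and $g(v)=0$, then no $u\in N_G(v)-W$ has $\phi(u)=f(v)$; and if $v\notin W$, or $v\in W$ and $g(v)=1$, then either $N_{G-E(H)}(v)=\emptyset$ or there is $i_v$ with $|\phi^{ -1}(\{i_v\})\cap N_{G-E(H)}(v)|\in S$. -}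

module Defs where

open import Data.Nat using (ℕ; zero; suc; _≤_; _<_; _≟_)
open import Data.Bool using (Bool; true; false; _∧_; not)
open import Data.Fin using (Fin)
open import Data.Fin.Subset using (Subset; _∈_; _∉_; _∩_; ∣_∣; Empty)
open import Data.Vec using (tabulate)
open import Data.Product using (Σ; ∃; _×_; _,_)
open import Data.Sum using (_⊎_)
open import Relation.Nullary using (¬_)
open import Relation.Nullary.Decidable using (⌊_⌋)
open import Relation.Binary.PropositionalEquality using (_≡_; _≢_)
open import Function.Bundles using (_⇔_)

record Graph (n : ℕ) : Set where
  field
    adj    : Fin n → Fin n → Bool
    sym    : ∀ u v → adj u v ≡ adj v u
    irrefl : ∀ v → adj v v ≡ false
open Graph public

E : ∀ {n} → Graph n → Fin n → Fin n → Set
E G u v = adj G u v ≡ true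

Clique : ∀ {n} → Graph n → Subset n → Set
Clique G W = ∀ u v → u ∈ W → v ∈ W → u ≢ v → E G u v

ListAssignment : ℕ → Set₁
ListAssignment n = Fin n → ℕ → Set

Collection : ℕ → Set₁
Collection n = Subset n → Set

-- A subgraph H of G (only its edge set matters for the definitions):
-- symmetric edge relation contained in E(G).
record Subgraph {n : ℕ} (G : Graph n) : Set where
  field
    hadj : Fin n → Fin n → Bool
    hsym : ∀ u v → hadj u v ≡ hadj v u
    hsub : ∀ u v → hadj u v ≡ true → E G u v
open Subgraph public

Compatible : ∀ {n} {G : Graph n} → Collection n → Subgraph G → Set
Compatible {n} C H = ∀ u v → hadj H u v ≡ true → ∃ λ X → C X × u ∈ X × v ∈ X

NbhdMinus : ∀ {n} (G : Graph n) → Subgraph G → Fin n → Subset n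
NbhdMinus G H v = tabulate λ u → adj G v u ∧ not (hadj H v u)

ColourClass : ∀ {n} → (Fin n → ℕ) → ℕ → Subset n
ColourClass φ i = tabulate λ u → ⌊ φ u ≟ i ⌋

ProperLColouring : ∀ {n} → Graph n → ListAssignment n → (Fin n → ℕ) → Set
ProperLColouring G L φ = (∀ v → L v (φ v)) × (∀ u v → E G u v → φ u ≢ φ v)

-- φ_W (a function defined on W; values outside W are irrelevant)
-- is a proper L|_W-coloring of G[W]
ProperLColouringOn : ∀ {n} → Graph n → ListAssignment n → Subset n → (Fin n → ℕ) → Set
ProperLColouringOn G L W φ =
  (∀ v → v ∈ W → L v (φ v)) × (∀ u v → u ∈ W → v ∈ W → E G u v → φ u ≢ φ v)

-- (S, C, L, t)-extendable. Functions with domain W are represented by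
-- functions on all of V(G) whose values outside W are ignored.
Extendable : ∀ {n} → (ℕ → Set) → Collection n → ListAssignment n → ℕ → Graph n → Set
Extendable {n} S C L t G =
  ∀ (W : Subset n) → Clique G W → ∣ W ∣ ≤ t →
  ∀ (H : Subgraph G) → Compatible C H →
  ∀ (φW : Fin n → ℕ) → ProperLColouringOn G L W φW →
  ∀ (f : Fin n → ℕ) (g : Fin n → Bool) →
  Σ (Fin n → ℕ) λ φ →
    ProperLColouring G L φ ×
    (∀ v → v ∈ W → φ v ≡ φW v) ×
    (∀ v → v ∈ W → g v ≡ false → ∀ u → E G v u → u ∉ W → φ u ≢ f v) ×
    (∀ v → (v ∉ W ⊎ (v ∈ W × g v ≡ true)) →
       Empty (NbhdMinus G H v) ⊎
       ∃ λ i → S ∣ ColourClass φ i ∩ NbhdMinus G H v ∣)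

-- ι : Q1 → Q2 is a bijection (ι given as a function on V(G1), relevant on Q1)
BijectionOn : ∀ {n₁ n₂} → Subset n₁ → Subset n₂ → (Fin n₁ → Fin n₂) → Set
BijectionOn Q₁ Q₂ ι =
  (∀ x → x ∈ Q₁ → ι x ∈ Q₂) ×
  (∀ x y → x ∈ Q₁ → y ∈ Q₁ → ι x ≡ ι y → x ≡ y) ×
  (∀ y → y ∈ Q₂ → ∃ λ x → x ∈ Q₁ × ι x ≡ y)

-- G, with embeddings α₁ : V(G₁) → V(G), α₂ : V(G₂) → V(G), is a
-- (Q₁,Q₂,ι)-sum of G₁ and G₂ (up to renaming of the vertices):
-- α₁(x) = v_x = α₂(ι x) for x ∈ Q₁, all other vertices are kept apart,
-- edges are those of G₁ and G₂, except that any edges with both ends in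
-- {v_x : x ∈ Q₁} may be deleted.
IsSum : ∀ {n₁ n₂ n} → Graph n₁ → Graph n₂ → Subset n₁ → Subset n₂ →
        (Fin n₁ → Fin n₂) → Graph n → (Fin n₁ → Fin n) → (Fin n₂ → Fin n) → Set
IsSum G₁ G₂ Q₁ Q₂ ι G α₁ α₂ =
  (∀ a b → α₁ a ≡ α₁ b → a ≡ b) ×
  (∀ a b → α₂ a ≡ α₂ b → a ≡ b) ×
  (∀ a b → α₁ a ≡ α₂ b → a ∈ Q₁ × ι a ≡ b) ×
  (∀ a → a ∈ Q₁ → α₁ a ≡ α₂ (ι a)) ×
  (∀ v → (∃ λ a → α₁ a ≡ v) ⊎ (∃ λ b → α₂ b ≡ v)) ×
  (∀ a b → E G (α₁ a) (α₁ b) → E G₁ a b) ×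
  (∀ a b → E G₁ a b → (a ∉ Q₁ ⊎ b ∉ Q₁) → E G (α₁ a) (α₁ b)) ×
  (∀ a b → E G (α₂ a) (α₂ b) → E G₂ a b) ×
  (∀ a b → E G₂ a b → (a ∉ Q₂ ⊎ b ∉ Q₂) → E G (α₂ a) (α₂ b)) ×
  (∀ a b → a ∉ Q₁ → b ∉ Q₂ → ¬ E G (α₁ a) (α₂ b))

IsSumLists : ∀ {n₁ n₂ n} → ListAssignment n₁ → ListAssignment n₂ → ListAssignment n →
             (Fin n₁ → Fin n) → (Fin n₂ → Fin n) → Set
IsSumLists L₁ L₂ L α₁ α₂ =
  (∀ a c → L (α₁ a) c ⇔ L₁ a c) × (∀ b c → L (α₂ b) c ⇔ L₂ b c)

IsImage : ∀ {m n} → (Fin m → Fin n) → Subset m → Subset n → Set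
IsImage α X Y = ∀ v → (v ∈ Y → ∃ λ x → x ∈ X × α x ≡ v) × (∀ x → x ∈ X → α x ≡ v → v ∈ Y)

UnionCollection : ∀ {n₁ n₂ n} → Collection n₁ → Collection n₂ →
                  (Fin n₁ → Fin n) → (Fin n₂ → Fin n) → Collection n
UnionCollection C₁ C₂ α₁ α₂ Y =
  (∃ λ X → C₁ X × IsImage α₁ X Y) ⊎ (∃ λ X → C₂ X × IsImage α₂ X Y)

-- A clique of G cannot meet both G₁ − Q₁ and G₂ − Q₂, so after exchanging the sides
-- if necessary the precoloured clique W lies on side A.  Extend first in G_A, with W,
-- H, f and g pulled back.  Then extend in G_B with the clique Q_B precoloured as G_A
-- coloured it, where f_B and g_B on Q_B record what each glued vertex v still needs
-- from side B: if v ∈ W and g v = 0, its B-neighbours must avoid f v; if v has no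
-- neighbours on side A, side B must provide the S-condition; if side A found a colour
-- i occurring an S-number of times around v, the B-neighbours of v must avoid i, so
-- that this count is unchanged in G.  Edges inside Q_B are put into H_B, so that
-- side B only counts the neighbours of v outside Q_B, which are exactly those side A
-- does not see.

module Submission where

open import Defs hiding (sym)
open import Data.Bool using (Bool; true; false; _∧_; not)
open import Data.Bool.Properties using (∧-conicalˡ; ∧-conicalʳ; ∧-comm; ∧-zeroʳ; ¬-not; T-≡; not-¬)
open import Data.Empty using (⊥-elim)
open import Data.Fin using (Fin; suc; _≟_)
open import Data.Fin.Properties using (0≢1+n; suc-injective; any?)
open import Data.Fin.Subset using (Subset; _∈_; _∉_; _⊆_; _∩_; _-_; ∣_∣; Empty; inside; outside)
  renaming (⊥ to ∅)
open import Data.Fin.Subset.Properties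
  using (_∈?_; ∉⊥; x∈p∩q⁺; x∈p∩q⁻; x∈p∧x≢y⇒x∈p-y; x∈p⇒∣p-x∣<∣p∣)
open import Data.Nat using (ℕ; _≤_; _<_; _⊓_; z≤n; s≤s)
import Data.Nat as ℕ
open import Data.Nat.Properties using (≤-trans; ≤-antisym; m⊓n≤m; m⊓n≤n)
import Data.Product as Prod
open import Data.Product using (∃; _×_; _,_; proj₁; proj₂; map₂)
open import Data.Sum using (_⊎_; inj₁; inj₂; swap; [_,_]′)
open import Data.Vec using (_∷_; []; lookup; tabulate; here; there)
open import Data.Vec.Properties using (lookup∘tabulate; []=⇒lookup; lookup⇒[]=)
open import Function using (_∘_)
open import Function.Bundles using (_⇔_; Equivalence)
open import Relation.Binary.PropositionalEquality
  using (_≡_; _≢_; refl; sym; trans; cong; cong₂; subst; subst₂)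
open import Relation.Nullary using (¬_; Dec; yes; no; contradiction)
open import Relation.Nullary.Decidable
  using (dec-true; isYes≗does; toWitness; decidable-stable; _×-dec_; ¬?)

E-sym : ∀ {n} (G : Graph n) {u v} → E G u v → E G v u
E-sym G {u} {v} uv = trans (Graph.sym G v u) uv

E⇒≢ : ∀ {n} (G : Graph n) {u v} → E G u v → u ≢ v
E⇒≢ G {u} uu refl with trans (sym (irrefl G u)) uu
... | ()

∧-not≡true⁻ : ∀ {p q} → p ∧ not q ≡ true → p ≡ true × q ≡ false
∧-not≡true⁻ {true} {false} refl = refl , refl
∧-not≡true⁻ {true} {true} ()
∧-not≡true⁻ {false} ()

∧-not≡true⁺ : ∀ {p q} → p ≡ true → q ≡ false → p ∧ not q ≡ true
∧-not≡true⁺ refl refl = refl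

∧-not≡false⁻ : ∀ p {q} → p ∧ not q ≡ false → p ≡ false ⊎ q ≡ true
∧-not≡false⁻ false _ = inj₁ refl
∧-not≡false⁻ true {true} _ = inj₂ refl
∧-not≡false⁻ true {false} ()

∧-not-∧-not : ∀ p q → p ∧ not (p ∧ not q) ≡ p ∧ q
∧-not-∧-not false _ = refl
∧-not-∧-not true true = refl
∧-not-∧-not true false = refl

∈-tabulate⁺ : ∀ {n} {f : Fin n → Bool} {x} → f x ≡ true → x ∈ tabulate f
∈-tabulate⁺ {f = f} {x} fx = lookup⇒[]= x (tabulate f) (trans (lookup∘tabulate f x) fx)

∈-tabulate⁻ : ∀ {n} {f : Fin n → Bool} {x} → x ∈ tabulate f → f x ≡ true
∈-tabulate⁻ {f = f} {x} x∈ = trans (sym (lookup∘tabulate f x)) ([]=⇒lookup x∈)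

∉⇒lookup≡false : ∀ {n} {p : Subset n} {x} → x ∉ p → lookup p x ≡ false
∉⇒lookup≡false {p = p} {x} x∉p = ¬-not (x∉p ∘ lookup⇒[]= x p)

preimage : ∀ {m n} → (Fin m → Fin n) → Subset n → Subset m
preimage α W = tabulate (lookup W ∘ α)

∈-preimage⁺ : ∀ {m n} {α : Fin m → Fin n} {W x} → α x ∈ W → x ∈ preimage α W
∈-preimage⁺ αx∈W = ∈-tabulate⁺ ([]=⇒lookup αx∈W)

∈-preimage⁻ : ∀ {m n} {α : Fin m → Fin n} {W x} → x ∈ preimage α W → α x ∈ W
∈-preimage⁻ {α = α} {W} {x} x∈ = lookup⇒[]= (α x) W (∈-tabulate⁻ x∈)

∈-ColourClass⁺ : ∀ {n} {φ : Fin n → ℕ} {i u} → φ u ≡ i → u ∈ ColourClass φ i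
∈-ColourClass⁺ {φ = φ} {i} {u} φu≡i =
  ∈-tabulate⁺ (trans (isYes≗does (φ u ℕ.≟ i)) (dec-true (φ u ℕ.≟ i) φu≡i))

∈-ColourClass⁻ : ∀ {n} {φ : Fin n → ℕ} {i u} → u ∈ ColourClass φ i → φ u ≡ i
∈-ColourClass⁻ {φ = φ} {i} {u} u∈ =
  toWitness {a? = φ u ℕ.≟ i} (Equivalence.from T-≡ (∈-tabulate⁻ u∈))

∈-NbhdMinus⁻ : ∀ {n} {G : Graph n} {H : Subgraph G} {v u} → u ∈ NbhdMinus G H v → E G v u
∈-NbhdMinus⁻ u∈ = ∧-conicalˡ _ _ (∈-tabulate⁻ u∈)

∣p∣≤∣q∣-byInjection : ∀ {m n} (R : Fin m → Fin n → Set) →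
  (∀ {a a' y} → R a y → R a' y → a ≡ a') →
  (X : Subset m) (Y : Subset n) → (∀ {a} → a ∈ X → ∃ λ y → y ∈ Y × R a y) → ∣ X ∣ ≤ ∣ Y ∣
∣p∣≤∣q∣-byInjection R inj [] Y total = z≤n
∣p∣≤∣q∣-byInjection R inj (outside ∷ X) Y total =
  ∣p∣≤∣q∣-byInjection (R ∘ suc) (λ r r' → suc-injective (inj r r')) X Y (total ∘ there)
∣p∣≤∣q∣-byInjection R inj (inside ∷ X) Y total with total here
... | y , y∈Y , r = ≤-trans (s≤s ∣X∣≤∣Y-y∣) (x∈p⇒∣p-x∣<∣p∣ y∈Y)
  where
  ∣X∣≤∣Y-y∣ : ∣ X ∣ ≤ ∣ Y - y ∣
  ∣X∣≤∣Y-y∣ = ∣p∣≤∣q∣-byInjection (R ∘ suc) (λ r r' → suc-injective (inj r r')) X (Y - y)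
    λ a∈X → let (y' , y'∈Y , r') = total (there a∈X)
            in y' , x∈p∧x≢y⇒x∈p-y y'∈Y (λ { refl → 0≢1+n (inj r r') }) , r'

∣p∣≡∣q∣-byInjection : ∀ {m n} (α : Fin m → Fin n) → (∀ {a a'} → α a ≡ α a' → a ≡ a') →
  (X : Subset m) (Y : Subset n) →
  (∀ {a} → a ∈ X → α a ∈ Y) → (∀ {y} → y ∈ Y → ∃ λ a → a ∈ X × α a ≡ y) → ∣ X ∣ ≡ ∣ Y ∣
∣p∣≡∣q∣-byInjection α inj X Y into onto = ≤-antisym
  (∣p∣≤∣q∣-byInjection (λ a y → α a ≡ y) (λ e e' → inj (trans e (sym e'))) X Y
    (λ a∈X → _ , into a∈X , refl))
  (∣p∣≤∣q∣-byInjection (λ y a → α a ≡ y) (λ e e' → trans (sym e) e') Y X onto)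

∣preimage∣≤∣p∣ : ∀ {m n} {α : Fin m → Fin n} → (∀ {a a'} → α a ≡ α a' → a ≡ a') →
  ∀ W → ∣ preimage α W ∣ ≤ ∣ W ∣
∣preimage∣≤∣p∣ {α = α} inj W = ∣p∣≤∣q∣-byInjection (λ a v → α a ≡ v)
  (λ e e' → inj (trans e (sym e'))) (preimage α W) W (λ a∈ → _ , ∈-preimage⁻ a∈ , refl)

∈-IsImage⁻ : ∀ {m n} {α : Fin m → Fin n} {X Y} → (∀ {a a'} → α a ≡ α a' → a ≡ a') →
  IsImage α X Y → ∀ {x} → α x ∈ Y → x ∈ X
∈-IsImage⁻ {α = α} {X} inj img {x} αx∈Y with proj₁ (img (α x)) αx∈Y
... | x' , x'∈X , αx'≡αx = subst (_∈ X) (inj αx'≡αx) x'∈X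

Compatible-mono : ∀ {n} {G : Graph n} {C C' : Collection n} {H : Subgraph G} →
  (∀ {X} → C X → C' X) → Compatible C H → Compatible C' H
Compatible-mono C⊆C' compat u v uv = map₂ (λ (cX , u∈ , v∈) → C⊆C' cX , u∈ , v∈) (compat u v uv)

Compatible-UnionCollection-swap : ∀ {n₁ n₂ n} {G : Graph n} {H : Subgraph G}
  {C₁ : Collection n₁} {C₂ : Collection n₂} {α₁ α₂} →
  Compatible (UnionCollection C₁ C₂ α₁ α₂) H → Compatible (UnionCollection C₂ C₁ α₂ α₁) H
Compatible-UnionCollection-swap {H = H} {C₁} {C₂} {α₁} {α₂} =
  Compatible-mono {C = UnionCollection C₁ C₂ α₁ α₂} {H = H} swap

S-Demanded : ∀ {n} → Subset n → (Fin n → Bool) → Fin n → Set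
S-Demanded W g v = v ∉ W ⊎ (v ∈ W × g v ≡ true)

S-Satisfied : ∀ {n} → (ℕ → Set) → (G : Graph n) → Subgraph G → (Fin n → ℕ) → Fin n → Set
S-Satisfied S G H φ v =
  Empty (NbhdMinus G H v) ⊎ ∃ λ i → S ∣ ColourClass φ i ∩ NbhdMinus G H v ∣

record Extension {n} (S : ℕ → Set) (G : Graph n) (L : ListAssignment n) (H : Subgraph G)
                 (W : Subset n) (φW f : Fin n → ℕ) (g : Fin n → Bool) : Set where
  field
    colouring   : Fin n → ℕ
    proper      : ProperLColouring G L colouring
    extends     : ∀ v → v ∈ W → colouring v ≡ φW v
    avoids      : ∀ v → v ∈ W → g v ≡ false → ∀ u → E G v u → u ∉ W → colouring u ≢ f v
    satisfies-S : ∀ v → S-Demanded W g v → S-Satisfied S G H colouring v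

Extendable⇒Extension : ∀ {n S C L t} {G : Graph n} → Extendable S C L t G →
  ∀ W → Clique G W → ∣ W ∣ ≤ t → ∀ H → Compatible C H →
  ∀ φW → ProperLColouringOn G L W φW → ∀ f g → Extension S G L H W φW f g
Extendable⇒Extension ext W W-clique ∣W∣≤t H compat φW φW-proper f g
  with ext W W-clique ∣W∣≤t H compat φW φW-proper f g
... | φ , proper , extends , avoids , satisfies-S = record
  { colouring = φ ; proper = proper ; extends = extends ; avoids = avoids
  ; satisfies-S = satisfies-S }

Extension⇒Extendable : ∀ {n S C L t} {G : Graph n} →
  (∀ W → Clique G W → ∣ W ∣ ≤ t → ∀ H → Compatible C H →
   ∀ φW → ProperLColouringOn G L W φW → ∀ f g → Extension S G L H W φW f g) →
  Extendable S C L t G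
Extension⇒Extendable ext W W-clique ∣W∣≤t H compat φW φW-proper f g =
  colouring , proper , extends , avoids , satisfies-S
  where open Extension (ext W W-clique ∣W∣≤t H compat φW φW-proper f g)

S-Demanded-or-pinned : ∀ {n} (W : Subset n) g v → S-Demanded W g v ⊎ (v ∈ W × g v ≡ false)
S-Demanded-or-pinned W g v with v ∈? W | g v
... | no v∉W | _ = inj₁ (inj₁ v∉W)
... | yes v∈W | true = inj₁ (inj₂ (v∈W , refl))
... | yes v∈W | false = inj₂ (v∈W , refl)

pinned⇒¬S-Demanded : ∀ {n} {W : Subset n} {g v} → v ∈ W → g v ≡ false → ¬ S-Demanded W g v
pinned⇒¬S-Demanded v∈W gv (inj₁ v∉W) = v∉W v∈W
pinned⇒¬S-Demanded v∈W gv (inj₂ (_ , gv')) with trans (sym gv) gv'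
... | ()

ProperLColouring-≗ : ∀ {n} {G : Graph n} {L φ ψ} → (∀ v → φ v ≡ ψ v) →
  ProperLColouring G L φ → ProperLColouring G L ψ
ProperLColouring-≗ {L = L} φ≗ψ (lists , edges) =
  (λ v → subst (L v) (φ≗ψ v) (lists v)) ,
  (λ u v uv ψu≡ψv → edges u v uv (trans (φ≗ψ u) (trans ψu≡ψv (sym (φ≗ψ v)))))

-- The structure of a (Q₁,Q₂,ι)-sum that the proof uses; ι only matters through which
-- vertices αA and αB identify, and the description is symmetric in the two sides.
record Gluing {nA nB n} (GA : Graph nA) (GB : Graph nB) (QA : Subset nA) (QB : Subset nB)
              (G : Graph n) (αA : Fin nA → Fin n) (αB : Fin nB → Fin n) : Set where
  field
    αA-injective : ∀ {a a'} → αA a ≡ αA a' → a ≡ a'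
    αB-injective : ∀ {b b'} → αB b ≡ αB b' → b ≡ b'
    glued⇒∈Q     : ∀ {a b} → αA a ≡ αB b → a ∈ QA × b ∈ QB
    QA-glued     : ∀ {a} → a ∈ QA → ∃ λ b → αB b ≡ αA a
    QB-glued     : ∀ {b} → b ∈ QB → ∃ λ a → αA a ≡ αB b
    covering     : ∀ v → (∃ λ a → αA a ≡ v) ⊎ (∃ λ b → αB b ≡ v)
    EA-reflect   : ∀ {a a'} → E G (αA a) (αA a') → E GA a a'
    EA-preserve  : ∀ {a a'} → E GA a a' → a ∉ QA ⊎ a' ∉ QA → E G (αA a) (αA a')
    EB-reflect   : ∀ {b b'} → E G (αB b) (αB b') → E GB b b'
    EB-preserve  : ∀ {b b'} → E GB b b' → b ∉ QB ⊎ b' ∉ QB → E G (αB b) (αB b')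
    no-cross-edge : ∀ {a b} → a ∉ QA → b ∉ QB → ¬ E G (αA a) (αB b)

swap-Gluing : ∀ {nA nB n} {GA : Graph nA} {GB : Graph nB} {QA QB} {G : Graph n} {αA αB} →
  Gluing GA GB QA QB G αA αB → Gluing GB GA QB QA G αB αA
swap-Gluing {G = G} gl = record
  { αA-injective = αB-injective
  ; αB-injective = αA-injective
  ; glued⇒∈Q = λ e → Prod.swap (glued⇒∈Q (sym e))
  ; QA-glued = QB-glued
  ; QB-glued = QA-glued
  ; covering = swap ∘ covering
  ; EA-reflect = EB-reflect
  ; EA-preserve = EB-preserve
  ; EB-reflect = EA-reflect
  ; EB-preserve = EA-preserve
  ; no-cross-edge = λ b∉ a∉ e → no-cross-edge a∉ b∉ (E-sym G e)
  }
  where open Gluing gl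

IsSum⇒Gluing : ∀ {n₁ n₂ n} {G₁ : Graph n₁} {G₂ : Graph n₂} {Q₁ Q₂ ι} {G : Graph n} {α₁ α₂} →
  BijectionOn Q₁ Q₂ ι → IsSum G₁ G₂ Q₁ Q₂ ι G α₁ α₂ → Gluing G₁ G₂ Q₁ Q₂ G α₁ α₂
IsSum⇒Gluing {Q₁ = Q₁} {Q₂} {ι} {α₁ = α₁} {α₂} (ι-into , _ , ι-onto)
  (α₁-inj , α₂-inj , glued , agree , cover , E₁→ , E₁← , E₂→ , E₂← , no-cross) = record
  { αA-injective = α₁-inj _ _
  ; αB-injective = α₂-inj _ _
  ; glued⇒∈Q = glued⇒∈Q
  ; QA-glued = λ {a} a∈ → ι a , sym (agree a a∈)
  ; QB-glued = QB-glued
  ; covering = cover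
  ; EA-reflect = E₁→ _ _
  ; EA-preserve = E₁← _ _
  ; EB-reflect = E₂→ _ _
  ; EB-preserve = E₂← _ _
  ; no-cross-edge = no-cross _ _
  }
  where
  glued⇒∈Q : ∀ {a b} → α₁ a ≡ α₂ b → a ∈ Q₁ × b ∈ Q₂
  glued⇒∈Q {a} e with glued a _ e
  ... | a∈ , refl = a∈ , ι-into a a∈
  QB-glued : ∀ {b} → b ∈ Q₂ → ∃ λ a → α₁ a ≡ α₂ b
  QB-glued {b} b∈ with ι-onto b b∈
  ... | a , a∈ , refl = a , agree a a∈

InImage : ∀ {m n} → (Fin m → Fin n) → Subset n → Set
InImage α W = ∀ v → v ∈ W → ∃ λ a → α a ≡ v

module GluingProperties {nA nB n} {GA : Graph nA} {GB : Graph nB} {QA QB} {G : Graph n} {αA αB}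
  (gl : Gluing GA GB QA QB G αA αB) where
  open Gluing gl

  InA⊎InteriorB : Fin n → Set
  InA⊎InteriorB v = (∃ λ a → αA a ≡ v) ⊎ (∃ λ b → b ∉ QB × αB b ≡ v)

  covering-interior : ∀ v → InA⊎InteriorB v
  covering-interior v with covering v
  ... | inj₁ a∈A = inj₁ a∈A
  ... | inj₂ (b , refl) with b ∈? QB
  ...   | yes b∈ = inj₁ (QB-glued b∈)
  ...   | no b∉ = inj₂ (b , b∉ , refl)

  glue : ∀ {X : Set} → (Fin nA → X) → (Fin nB → X) → Fin n → X
  glue p q v = [ p ∘ proj₁ , q ∘ proj₁ ]′ (covering-interior v)

  glue-αA : ∀ {X : Set} (p : Fin nA → X) q a → glue p q (αA a) ≡ p a
  glue-αA p q a with covering-interior (αA a)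
  ... | inj₁ (a' , e) = cong p (αA-injective e)
  ... | inj₂ (b , b∉ , e) = contradiction (proj₂ (glued⇒∈Q (sym e))) b∉

  glue-αB-glued : ∀ {X : Set} (p : Fin nA → X) q {a b} → αA a ≡ αB b → glue p q (αB b) ≡ p a
  glue-αB-glued p q {a} e = subst (λ v → glue p q v ≡ p a) e (glue-αA p q a)

  glue-αB-interior : ∀ {X : Set} (p : Fin nA → X) q {b} → b ∉ QB → glue p q (αB b) ≡ q b
  glue-αB-interior p q {b} b∉ with covering-interior (αB b)
  ... | inj₁ (a , e) = contradiction (proj₂ (glued⇒∈Q e)) b∉
  ... | inj₂ (b' , _ , e) = cong q (αB-injective e)

  interior-neighbour-in-A : ∀ {a u} → a ∉ QA → E G (αA a) u → ∃ λ a' → αA a' ≡ u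
  interior-neighbour-in-A {u = u} a∉ au with covering-interior u
  ... | inj₁ u∈A = u∈A
  ... | inj₂ (b , b∉ , refl) = contradiction au (no-cross-edge a∉ b∉)

  lost-edge⇒∈QA : ∀ {a a'} → E GA a a' → ¬ E G (αA a) (αA a') → a ∈ QA × a' ∈ QA
  lost-edge⇒∈QA {a} {a'} aa' lost =
    decidable-stable (a ∈? QA) (λ a∉ → lost (EA-preserve aa' (inj₁ a∉))) ,
    decidable-stable (a' ∈? QA) (λ a'∉ → lost (EA-preserve aa' (inj₂ a'∉)))

  glued-proper : ∀ {LA LB L} → IsSumLists LA LB L αA αB → (φ : Fin n → ℕ) →
    ProperLColouring GA LA (φ ∘ αA) → ProperLColouring GB LB (φ ∘ αB) → ProperLColouring G L φ
  glued-proper {L = L} (LA⇔ , LB⇔) φ (listsA , edgesA) (listsB , edgesB) = lists , edges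
    where
    lists : ∀ v → L v (φ v)
    lists v with covering v
    ... | inj₁ (a , refl) = Equivalence.from (LA⇔ a _) (listsA a)
    ... | inj₂ (b , refl) = Equivalence.from (LB⇔ b _) (listsB b)

    edgeAB : ∀ {a b} → b ∉ QB → E G (αA a) (αB b) → φ (αA a) ≢ φ (αB b)
    edgeAB {a} {b} b∉ ab with a ∈? QA
    ... | no a∉ = contradiction ab (no-cross-edge a∉ b∉)
    ... | yes a∈ with QA-glued a∈
    ...   | b' , e = subst (λ u → φ u ≢ φ (αB b)) e
      (edgesB b' b (EB-reflect (subst (λ u → E G u (αB b)) (sym e) ab)))

    edges : ∀ u v → E G u v → φ u ≢ φ v
    edges u v uv with covering-interior u | covering-interior v
    ... | inj₁ (a , refl) | inj₁ (a' , refl) = edgesA _ _ (EA-reflect uv)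
    ... | inj₁ (a , refl) | inj₂ (b , b∉ , refl) = edgeAB b∉ uv
    ... | inj₂ (b , b∉ , refl) | inj₁ (a , refl) = edgeAB b∉ (E-sym G uv) ∘ sym
    ... | inj₂ (b , _ , refl) | inj₂ (b' , _ , refl) = edgesB _ _ (EB-reflect uv)

clique-in-one-side : ∀ {nA nB n} {GA : Graph nA} {GB : Graph nB} {QA QB} {G : Graph n} {αA αB} →
  Gluing GA GB QA QB G αA αB → ∀ W → Clique G W → InImage αA W ⊎ InImage αB W
clique-in-one-side {αA = αA} {αB} gl W W-clique
  with any? (λ v → (v ∈? W) ×-dec ¬? (any? λ a → αA a ≟ v))
... | no ∄outside = inj₁ λ v v∈W →
  decidable-stable (any? λ a → αA a ≟ v) (λ v∉A → ∄outside (v , v∈W , v∉A))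
... | yes (v , v∈W , v∉A) with GluingProperties.covering-interior gl v
...   | inj₁ v∈A = contradiction v∈A v∉A
...   | inj₂ (b , b∉ , refl) = inj₂ w∈B
  where
  -- every other vertex of W is a neighbour of the B-interior vertex αB b
  w∈B : InImage αB W
  w∈B w w∈W with w ≟ αB b
  ... | yes refl = b , refl
  ... | no w≢v = GluingProperties.interior-neighbour-in-A (swap-Gluing gl) b∉
                   (W-clique _ _ v∈W w∈W (w≢v ∘ sym))

module Restriction {nA nB n} {GA : Graph nA} {GB : Graph nB} {QA QB} {G : Graph n} {αA αB}
  (gl : Gluing GA GB QA QB G αA αB)
  {CA : Collection nA} {CB : Collection nB} (CA∋QA : CA QA)
  (H : Subgraph G) (compat : Compatible (UnionCollection CA CB αA αB) H)
  (K : Subset nA) (K⊆QA : K ⊆ QA) where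
  open Gluing gl
  open GluingProperties gl using (lost-edge⇒∈QA)

  both-in-K : Fin nA → Fin nA → Bool
  both-in-K x x' = lookup K x ∧ lookup K x'

  both-in-K⁻ : ∀ {x x'} → both-in-K x x' ≡ true → x ∈ K × x' ∈ K
  both-in-K⁻ {x} {x'} e = lookup⇒[]= x K (∧-conicalˡ _ _ e) , lookup⇒[]= x' K (∧-conicalʳ _ _ e)

  not-both-in-K : ∀ {x x'} → x ∉ K ⊎ x' ∉ K → both-in-K x x' ≡ false
  not-both-in-K {x} {x'} (inj₁ x∉) = cong (_∧ lookup K x') (∉⇒lookup≡false x∉)
  not-both-in-K {x} {x'} (inj₂ x'∉) = trans (cong (lookup K x ∧_) (∉⇒lookup≡false x'∉)) (∧-zeroʳ _)

  -- An edge of G_A stays outside H_A iff it is an edge of G − E(H) not inside K.  For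
  -- K = ∅ this pulls H back to G_A; on side B, K = Q_B makes G_B − E(H_B) see only
  -- the neighbours outside Q_B of a vertex of Q_B.
  survives : Fin nA → Fin nA → Bool
  survives x x' = (adj G (αA x) (αA x') ∧ not (hadj H (αA x) (αA x'))) ∧ not (both-in-K x x')

  hadjA : Fin nA → Fin nA → Bool
  hadjA x x' = adj GA x x' ∧ not (survives x x')

  hadjA-sym : ∀ x x' → hadjA x x' ≡ hadjA x' x
  hadjA-sym x x' rewrite Graph.sym GA x x' | Graph.sym G (αA x) (αA x')
                       | hsym H (αA x) (αA x') | ∧-comm (lookup K x) (lookup K x') = refl

  HA : Subgraph GA
  HA = record { hadj = hadjA ; hsym = hadjA-sym ; hsub = λ _ _ → ∧-conicalˡ _ _ }

  glued⇒∈QA : ∀ {Z Y x} → IsImage αB Z Y → αA x ∈ Y → x ∈ QA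
  glued⇒∈QA {x = x} img αx∈Y with proj₁ (img (αA x)) αx∈Y
  ... | _ , _ , e = proj₁ (glued⇒∈Q (sym e))

  compatible : Compatible CA HA
  compatible x x' e with ∧-not≡true⁻ e
  ... | xx' , lost with ∧-not≡false⁻ _ lost
  ... | inj₂ inK = QA , CA∋QA , Prod.map K⊆QA K⊆QA (both-in-K⁻ inK)
  ... | inj₁ notNbr with ∧-not≡false⁻ (adj G (αA x) (αA x')) notNbr
  ...   | inj₁ notG = QA , CA∋QA , lost-edge⇒∈QA xx' (not-¬ notG)
  ...   | inj₂ inH with compat (αA x) (αA x') inH
  ...     | _ , inj₁ (Z , CZ , img) , x∈ , x'∈ =
              Z , CZ , ∈-IsImage⁻ αA-injective img x∈ , ∈-IsImage⁻ αA-injective img x'∈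
  ...     | _ , inj₂ (_ , _ , img) , x∈ , x'∈ = QA , CA∋QA , glued⇒∈QA img x∈ , glued⇒∈QA img x'∈

  ∈-NA⁻ : ∀ {x x'} → x' ∈ NbhdMinus GA HA x → αA x' ∈ NbhdMinus G H (αA x)
  ∈-NA⁻ {x} {x'} x'∈ = ∈-tabulate⁺ (∧-conicalˡ _ _ survives≡true)
    where
    survives≡true : survives x x' ≡ true
    survives≡true = ∧-conicalʳ (adj GA x x') (survives x x')
      (trans (sym (∧-not-∧-not (adj GA x x') (survives x x'))) (∈-tabulate⁻ x'∈))

  ∈-NA⁺ : ∀ {x x'} → αA x' ∈ NbhdMinus G H (αA x) → x ∉ K ⊎ x' ∉ K → x' ∈ NbhdMinus GA HA x
  ∈-NA⁺ {x} {x'} αx'∈ notK =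
    ∈-tabulate⁺ (trans (∧-not-∧-not (adj GA x x') (survives x x')) (cong₂ _∧_ xx' surv))
    where
    nbr : adj G (αA x) (αA x') ∧ not (hadj H (αA x) (αA x')) ≡ true
    nbr = ∈-tabulate⁻ αx'∈
    xx' : E GA x x'
    xx' = EA-reflect (∧-conicalˡ _ _ nbr)
    surv : survives x x' ≡ true
    surv = ∧-not≡true⁺ nbr (not-both-in-K notK)

  Lifts : Fin nA → Fin n → Set
  Lifts x u = ∃ λ x' → (x ∉ K ⊎ x' ∉ K) × αA x' ≡ u

  module _ {φA : Fin nA → ℕ} {φ : Fin n → ℕ} (φ∘αA : ∀ x → φ (αA x) ≡ φA x) where

    ∣ColourClass∩NA∣≡ : ∀ {x} i → (∀ {u} → u ∈ ColourClass φ i ∩ NbhdMinus G H (αA x) → Lifts x u) →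
      ∣ ColourClass φA i ∩ NbhdMinus GA HA x ∣ ≡ ∣ ColourClass φ i ∩ NbhdMinus G H (αA x) ∣
    ∣ColourClass∩NA∣≡ {x} i lifts = ∣p∣≡∣q∣-byInjection αA αA-injective _ _ into onto
      where
      into : ∀ {x'} → x' ∈ ColourClass φA i ∩ NbhdMinus GA HA x →
             αA x' ∈ ColourClass φ i ∩ NbhdMinus G H (αA x)
      into x'∈ with x∈p∩q⁻ _ _ x'∈
      ... | c , n = x∈p∩q⁺ (∈-ColourClass⁺ (trans (φ∘αA _) (∈-ColourClass⁻ c)) , ∈-NA⁻ n)
      onto : ∀ {u} → u ∈ ColourClass φ i ∩ NbhdMinus G H (αA x) →
             ∃ λ x' → x' ∈ ColourClass φA i ∩ NbhdMinus GA HA x × αA x' ≡ u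
      onto u∈ with lifts u∈ | x∈p∩q⁻ _ _ u∈
      ... | x' , k , refl | c , n =
        x' , x∈p∩q⁺ (∈-ColourClass⁺ (trans (sym (φ∘αA x')) (∈-ColourClass⁻ c)) , ∈-NA⁺ n k) , refl

    S-Satisfied-lift : ∀ {S x} → S-Satisfied S GA HA φA x →
      (∀ {u} → u ∈ NbhdMinus G H (αA x) → Lifts x u) → S-Satisfied S G H φ (αA x)
    S-Satisfied-lift {x = x} (inj₁ empty) lifts = inj₁ emptyG
      where
      emptyG : Empty (NbhdMinus G H (αA x))
      emptyG (u , u∈) with lifts u∈
      ... | x' , k , refl = empty (x' , ∈-NA⁺ u∈ k)
    S-Satisfied-lift {S} (inj₂ (i , s)) lifts =
      inj₂ (i , subst S (∣ColourClass∩NA∣≡ i (lifts ∘ proj₂ ∘ x∈p∩q⁻ _ _)) s)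

module SideExtension (S : ℕ → Set)
  {nA nB n} {GA : Graph nA} {GB : Graph nB} {QA QB} {G : Graph n} {αA αB}
  (gl : Gluing GA GB QA QB G αA αB) (QA-clique : Clique GA QA) (QB-clique : Clique GB QB)
  {CA : Collection nA} {CB : Collection nB} (CA∋QA : CA QA) (CB∋QB : CB QB)
  {LA LB L} (lists : IsSumLists LA LB L αA αB)
  {tA tB} (∣QB∣≤tB : ∣ QB ∣ ≤ tB)
  (extA : Extendable S CA LA tA GA) (extB : Extendable S CB LB tB GB)
  (W : Subset n) (W-clique : Clique G W) (∣W∣≤tA : ∣ W ∣ ≤ tA) (W⊆A : InImage αA W)
  (H : Subgraph G) (compat : Compatible (UnionCollection CA CB αA αB) H)
  (φW : Fin n → ℕ) (φW-proper : ProperLColouringOn G L W φW)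
  (f : Fin n → ℕ) (g : Fin n → Bool) where

  open Gluing gl
  open GluingProperties gl
  module B = GluingProperties (swap-Gluing gl)

  WA : Subset nA
  WA = preimage αA W

  WA-clique : Clique GA WA
  WA-clique a a' a∈ a'∈ a≢a' =
    EA-reflect (W-clique _ _ (∈-preimage⁻ a∈) (∈-preimage⁻ a'∈) (a≢a' ∘ αA-injective))

  ∣WA∣≤tA : ∣ WA ∣ ≤ tA
  ∣WA∣≤tA = ≤-trans (∣preimage∣≤∣p∣ αA-injective W) ∣W∣≤tA

  φWA-proper : ProperLColouringOn GA LA WA (φW ∘ αA)
  φWA-proper =
    (λ a a∈ → Equivalence.to (proj₁ lists a _) (proj₁ φW-proper _ (∈-preimage⁻ a∈))) ,
    (λ a a' a∈ a'∈ aa' → proj₂ φW-proper _ _ (∈-preimage⁻ a∈) (∈-preimage⁻ a'∈)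
       (W-clique _ _ (∈-preimage⁻ a∈) (∈-preimage⁻ a'∈) (E⇒≢ GA aa' ∘ αA-injective)))

  S-Demanded-pull : ∀ {a} → S-Demanded W g (αA a) → S-Demanded WA (g ∘ αA) a
  S-Demanded-pull (inj₁ v∉W) = inj₁ (v∉W ∘ ∈-preimage⁻)
  S-Demanded-pull (inj₂ (v∈W , gv)) = inj₂ (∈-preimage⁺ v∈W , gv)

  module RA = Restriction gl CA∋QA H compat ∅ (λ x∈∅ → contradiction x∈∅ ∉⊥)

  extensionA : Extension S GA LA RA.HA WA (φW ∘ αA) (f ∘ αA) (g ∘ αA)
  extensionA = Extendable⇒Extension extA WA WA-clique ∣WA∣≤tA RA.HA RA.compatible
                 (φW ∘ αA) φWA-proper (f ∘ αA) (g ∘ αA)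

  open Extension extensionA using () renaming
    ( colouring to φA ; proper to φA-proper ; extends to φA-extends ; avoids to φA-avoids
    ; satisfies-S to φA-S )

  NA : Fin nA → Subset nA
  NA = NbhdMinus GA RA.HA

  data Demand (a : Fin nA) : Set where
    avoid-f      : αA a ∈ W → g (αA a) ≡ false → Demand a
    satisfy-S    : S-Demanded W g (αA a) → Empty (NA a) → Demand a
    avoid-colour : S-Demanded W g (αA a) → ∀ i → S ∣ ColourClass φA i ∩ NA a ∣ → Demand a

  demand : ∀ a → Demand a
  demand a with S-Demanded-or-pinned W g (αA a)
  ... | inj₂ (v∈W , gv) = avoid-f v∈W gv
  ... | inj₁ d with φA-S a (S-Demanded-pull d)
  ...   | inj₁ empty = satisfy-S d empty
  ...   | inj₂ (i , s) = avoid-colour d i s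

  demanded-g : ∀ {a} → Demand a → Bool
  demanded-g (avoid-f _ _) = false
  demanded-g (satisfy-S _ _) = true
  demanded-g (avoid-colour _ _ _) = false

  demanded-f : ∀ {a} → Demand a → ℕ
  demanded-f {a} (avoid-f _ _) = f (αA a)
  demanded-f (satisfy-S _ _) = 0
  demanded-f (avoid-colour _ i _) = i

  pinned-demand : ∀ {a} → αA a ∈ W → g (αA a) ≡ false →
    demanded-g (demand a) ≡ false × demanded-f (demand a) ≡ f (αA a)
  pinned-demand {a} v∈W gv with demand a
  ... | avoid-f _ _ = refl , refl
  ... | satisfy-S d _ = contradiction d (pinned⇒¬S-Demanded {g = g} v∈W gv)
  ... | avoid-colour d _ _ = contradiction d (pinned⇒¬S-Demanded {g = g} v∈W gv)

  -- Only the values on QB matter.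
  φWB : Fin nB → ℕ
  φWB = glue φA (λ _ → 0) ∘ αB

  gB : Fin nB → Bool
  gB = glue (demanded-g ∘ demand) (λ _ → true) ∘ αB

  fB : Fin nB → ℕ
  fB = glue (demanded-f ∘ demand) (λ _ → 0) ∘ αB

  φWB-glued : ∀ {a b} → αA a ≡ αB b → φWB b ≡ φA a
  φWB-glued = glue-αB-glued φA (λ _ → 0)

  gB-glued : ∀ {a b} → αA a ≡ αB b → gB b ≡ demanded-g (demand a)
  gB-glued = glue-αB-glued (demanded-g ∘ demand) (λ _ → true)

  fB-glued : ∀ {a b} → αA a ≡ αB b → fB b ≡ demanded-f (demand a)
  fB-glued = glue-αB-glued (demanded-f ∘ demand) (λ _ → 0)

  LA⇒LB : ∀ {a b c} → αA a ≡ αB b → LA a c → LB b c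
  LA⇒LB {a} {b} {c} e =
    Equivalence.to (proj₂ lists b c) ∘ subst (λ v → L v c) e ∘ Equivalence.from (proj₁ lists a c)

  φWB-proper : ProperLColouringOn GB LB QB φWB
  φWB-proper = lists-QB , edges-QB
    where
    lists-QB : ∀ b → b ∈ QB → LB b (φWB b)
    lists-QB b b∈ with QB-glued b∈
    ... | a , e = subst (LB b) (sym (φWB-glued e)) (LA⇒LB e (proj₁ φA-proper a))

    edges-QB : ∀ b b' → b ∈ QB → b' ∈ QB → E GB b b' → φWB b ≢ φWB b'
    edges-QB b b' b∈ b'∈ bb' with QB-glued b∈ | QB-glued b'∈
    ... | a , e | a' , e' =
      subst₂ _≢_ (sym (φWB-glued e)) (sym (φWB-glued e'))
        (proj₂ φA-proper a a' (QA-clique a a' (proj₁ (glued⇒∈Q e)) (proj₁ (glued⇒∈Q e'))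
          λ { refl → E⇒≢ GB bb' (αB-injective (trans (sym e) e')) }))

  module RB = Restriction (swap-Gluing gl) CB∋QB
    H (Compatible-UnionCollection-swap {H = H} compat) QB (λ b∈ → b∈)

  extensionB : Extension S GB LB RB.HA QB φWB fB gB
  extensionB =
    Extendable⇒Extension extB QB QB-clique ∣QB∣≤tB RB.HA RB.compatible φWB φWB-proper fB gB

  open Extension extensionB using () renaming
    ( colouring to φB ; proper to φB-proper ; extends to φB-extends ; avoids to φB-avoids
    ; satisfies-S to φB-S )

  -- Opaque because everything below only needs φ∘αA and φ∘αB, while unfolding the case
  -- split inside glue makes with-abstraction over goals mentioning φ very slow.
  opaque
    φ : Fin n → ℕ
    φ = glue φA φB

    φ∘αA : ∀ a → φ (αA a) ≡ φA a
    φ∘αA = glue-αA φA φB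

    φ∘αB : ∀ b → φ (αB b) ≡ φB b
    φ∘αB b = by-cases (b ∈? QB)
      where
      by-cases : Dec (b ∈ QB) → φ (αB b) ≡ φB b
      by-cases (no b∉) = glue-αB-interior φA φB b∉
      by-cases (yes b∈) = let (a , e) = QB-glued b∈ in
        trans (glue-αB-glued φA φB e) (trans (sym (φWB-glued e)) (sym (φB-extends b b∈)))

  φ-extends : ∀ v → v ∈ W → φ v ≡ φW v
  φ-extends v v∈W with W⊆A v v∈W
  ... | a , refl = trans (φ∘αA a) (φA-extends a (∈-preimage⁺ v∈W))

  pinned-avoids-via-B : ∀ {a b'} → αA a ∈ W → g (αA a) ≡ false → b' ∉ QB →
    E G (αA a) (αB b') → φ (αB b') ≢ f (αA a)
  pinned-avoids-via-B {a} {b'} v∈W gv b'∉ ab' with a ∈? QA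
  ... | no a∉ = contradiction ab' (no-cross-edge a∉ b'∉)
  ... | yes a∈ with QA-glued a∈ | pinned-demand v∈W gv
  ...   | b , e | gb≡false , fb≡fv =
    subst₂ _≢_ (sym (φ∘αB b')) (trans (fB-glued (sym e)) fb≡fv)
      (φB-avoids b (proj₂ (glued⇒∈Q (sym e))) (trans (gB-glued (sym e)) gb≡false) b'
        (EB-reflect (subst (λ v → E G v (αB b')) (sym e) ab')) b'∉)

  φ-avoids : ∀ v → v ∈ W → g v ≡ false → ∀ u → E G v u → u ∉ W → φ u ≢ f v
  φ-avoids v v∈W gv u vu u∉W with W⊆A v v∈W | covering-interior u
  ... | a , refl | inj₁ (a' , refl) = subst (_≢ f (αA a)) (sym (φ∘αA a'))
    (φA-avoids a (∈-preimage⁺ v∈W) gv a' (EA-reflect vu) (u∉W ∘ ∈-preimage⁻))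
  ... | a , refl | inj₂ (b' , b'∉ , refl) = pinned-avoids-via-B v∈W gv b'∉ vu

  S-at-A-interior : ∀ {a} → a ∉ QA → S-Demanded W g (αA a) → S-Satisfied S G H φ (αA a)
  S-at-A-interior {a} a∉ d = RA.S-Satisfied-lift {φ = φ} φ∘αA {S} (φA-S a (S-Demanded-pull d))
    (map₂ (inj₁ ∉⊥ ,_) ∘ interior-neighbour-in-A a∉ ∘ ∈-NbhdMinus⁻ {G = G} {H})

  S-at-B-interior : ∀ {b} → b ∉ QB → S-Satisfied S G H φ (αB b)
  S-at-B-interior {b} b∉ = RB.S-Satisfied-lift {φ = φ} φ∘αB {S} (φB-S b (inj₁ b∉))
    (map₂ (inj₁ b∉ ,_) ∘ B.interior-neighbour-in-A b∉ ∘ ∈-NbhdMinus⁻ {G = G} {H})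

  S-Satisfied-via-B : ∀ {a b} → αA a ≡ αB b → Empty (NA a) → gB b ≡ true →
    S-Satisfied S G H φ (αB b)
  S-Satisfied-via-B {a} {b} e empty gb≡true =
    RB.S-Satisfied-lift {φ = φ} φ∘αB {S} (φB-S b (inj₂ (proj₂ (glued⇒∈Q e) , gb≡true))) lifts
    where
    lifts : ∀ {u} → u ∈ NbhdMinus G H (αB b) → RB.Lifts b u
    lifts {u} u∈ with covering-interior u
    ... | inj₁ (a' , refl) =
      ⊥-elim (empty (a' , RA.∈-NA⁺ (subst (λ v → αA a' ∈ NbhdMinus G H v) (sym e) u∈) (inj₁ ∉⊥)))
    ... | inj₂ (b' , b'∉ , αb'≡u) = b' , inj₂ b'∉ , αb'≡u

  ∣ColourClass∩N∣-via-A : ∀ {a b i} → αA a ≡ αB b → gB b ≡ false → fB b ≡ i →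
    ∣ ColourClass φA i ∩ NA a ∣ ≡ ∣ ColourClass φ i ∩ NbhdMinus G H (αA a) ∣
  ∣ColourClass∩N∣-via-A {a} {b} {i} e gb≡false fb≡i = RA.∣ColourClass∩NA∣≡ {φ = φ} φ∘αA i lifts
    where
    lifts : ∀ {u} → u ∈ ColourClass φ i ∩ NbhdMinus G H (αA a) → RA.Lifts a u
    lifts {u} u∈ with covering-interior u | x∈p∩q⁻ _ _ u∈
    ... | inj₁ (a' , αa'≡u) | _ = a' , inj₁ ∉⊥ , αa'≡u
    ... | inj₂ (b' , b'∉ , refl) | u∈class , u∈N =
      contradiction (trans (sym (φ∘αB b')) (trans (∈-ColourClass⁻ u∈class) (sym fb≡i)))
        (φB-avoids b (proj₂ (glued⇒∈Q e)) gb≡false b'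
          (EB-reflect (subst (λ v → E G v (αB b')) e (∈-NbhdMinus⁻ {G = G} {H} u∈N))) b'∉)

  S-at-QA : ∀ {a} → a ∈ QA → S-Demanded W g (αA a) → S-Satisfied S G H φ (αA a)
  S-at-QA {a} a∈ d with QA-glued a∈ | demand a in demand≡
  ... | _ | avoid-f v∈W gv = contradiction d (pinned⇒¬S-Demanded {g = g} v∈W gv)
  ... | b , e | satisfy-S _ empty = subst (S-Satisfied S G H φ) e
    (S-Satisfied-via-B (sym e) empty (trans (gB-glued (sym e)) (cong demanded-g demand≡)))
  ... | b , e | avoid-colour _ i s = inj₂ (i , subst S (∣ColourClass∩N∣-via-A (sym e)
    (trans (gB-glued (sym e)) (cong demanded-g demand≡))
    (trans (fB-glued (sym e)) (cong demanded-f demand≡))) s)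

  φ-satisfies-S : ∀ v → S-Demanded W g v → S-Satisfied S G H φ v
  φ-satisfies-S v d with covering-interior v
  ... | inj₂ (b , b∉ , refl) = S-at-B-interior b∉
  ... | inj₁ (a , refl) with a ∈? QA
  ...   | no a∉ = S-at-A-interior a∉ d
  ...   | yes a∈ = S-at-QA a∈ d

  extension : Extension S G L H W φW f g
  extension = record
    { colouring = φ
    ; proper = glued-proper {LA = LA} {LB} {L} lists φ
                 (ProperLColouring-≗ {G = GA} {LA} (sym ∘ φ∘αA) φA-proper)
                 (ProperLColouring-≗ {G = GB} {LB} (sym ∘ φ∘αB) φB-proper)
    ; extends = φ-extends
    ; avoids = φ-avoids
    ; satisfies-S = φ-satisfies-S
    }

lemma3p1 : (S : ℕ → Set) → (∀ k → S k → 0 < k) → (t : ℕ) →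
    ∀ {n₁ n₂ n} (G₁ : Graph n₁) (G₂ : Graph n₂)
    (Q₁ : Subset n₁) (Q₂ : Subset n₂) →
    Clique G₁ Q₁ → ∣ Q₁ ∣ ≡ t → Clique G₂ Q₂ → ∣ Q₂ ∣ ≡ t →
    (C₁ : Collection n₁) (C₂ : Collection n₂) → C₁ Q₁ → C₂ Q₂ →
    (ι : Fin n₁ → Fin n₂) → BijectionOn Q₁ Q₂ ι →
    (L₁ : ListAssignment n₁) (L₂ : ListAssignment n₂) →
    (∀ x → x ∈ Q₁ → ∀ c → L₁ x c ⇔ L₂ (ι x) c) →
    (G : Graph n) (α₁ : Fin n₁ → Fin n) (α₂ : Fin n₂ → Fin n) →
    IsSum G₁ G₂ Q₁ Q₂ ι G α₁ α₂ →
    (L : ListAssignment n) → IsSumLists L₁ L₂ L α₁ α₂ →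
    (t₁ t₂ : ℕ) → t ≤ t₁ → t ≤ t₂ →
    Extendable S C₁ L₁ t₁ G₁ → Extendable S C₂ L₂ t₂ G₂ →
    Extendable S (UnionCollection C₁ C₂ α₁ α₂) L (t₁ ⊓ t₂) G
lemma3p1 S _ t G₁ G₂ Q₁ Q₂ Q₁-clique ∣Q₁∣≡t Q₂-clique ∣Q₂∣≡t C₁ C₂ C₁∋Q₁ C₂∋Q₂ ι ι-bijective
  L₁ L₂ _ G α₁ α₂ sum L lists t₁ t₂ t≤t₁ t≤t₂ ext₁ ext₂ =
  Extension⇒Extendable {L = L} λ W W-clique ∣W∣≤t₁⊓t₂ H compat φW φW-proper f g →
    [ (λ W⊆₁ → SideExtension.extension S gl Q₁-clique Q₂-clique C₁∋Q₁ C₂∋Q₂ {L₁} {L₂} {L} lists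
                 (subst (_≤ t₂) (sym ∣Q₂∣≡t) t≤t₂) ext₁ ext₂
                 W W-clique (≤-trans ∣W∣≤t₁⊓t₂ (m⊓n≤m t₁ t₂)) W⊆₁ H compat φW φW-proper f g)
    , (λ W⊆₂ → SideExtension.extension S (swap-Gluing gl) Q₂-clique Q₁-clique C₂∋Q₂ C₁∋Q₁
                 {L₂} {L₁} {L} (Prod.swap lists) (subst (_≤ t₁) (sym ∣Q₁∣≡t) t≤t₁) ext₂ ext₁
                 W W-clique (≤-trans ∣W∣≤t₁⊓t₂ (m⊓n≤n t₁ t₂)) W⊆₂
                 H (Compatible-UnionCollection-swap {H = H} compat) φW φW-proper f g)
    ]′ (clique-in-one-side gl W W-clique)
  where
  gl : Gluing G₁ G₂ Q₁ Q₂ G α₁ α₂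
  gl = IsSum⇒Gluing ι-bijective sum
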